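{- Let $P\in\mathcal Q_0$, let $\xi\in\mathbb{F}_{q^2}$ with $\xi^{2(q-1)}=1$, and let $R\neq P$ be a point of $S_\xi\cap P^\perp$. Then the line $PR$ is contained in $S_\xi$.
   Context: Let $q$ be an odd prime power; points of $\mathrm{PG}(3,q^2)$ are $\langle(\alpha,\beta,\gamma,\delta)\rangle$. Let $Q=\alpha\delta-\beta\gamma$, $H=\alpha^{q+1}-\beta^{q+1}-\gamma^{q+1}+\delta^{q+1}$. $\perp$ is the polarity of the Hermitian surface $H=0$: $\langle p\rangle^\perp=\{\langle x\rangle:x_1p_1^q-x_2p_2^q-x_3p_3^q+x_4p_4^q=0\}$. $\Sigma=\{\langle(\alpha,\beta,\beta^q,\alpha^q)\rangle\}\cong\mathrm{PG}(3,q)$ and $\mathcal Q_0=\{Q=0\}\cap\Sigma$. For $\xi\in\mathbb{F}_{q^2}$, $S_\xi$ is the set of points with $H-2\xi Q^{(q+1)/2}=0$. -}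

module Defs where

open import Level using (Level; _⊔_)
open import Algebra.Bundles using (CommutativeRing)
open import Data.Nat as ℕ using (ℕ; zero; suc)
open import Data.Nat.DivMod using (_/_)
open import Data.Nat.Primality using (Prime)
open import Data.Nat.Divisibility using (_∣_)
open import Data.Fin using (Fin)
open import Data.Product using (Σ; ∃; ∃₂; _×_)
open import Relation.Nullary using (¬_)
open import Function.Bundles using (Bijection)
import Relation.Binary.PropositionalEquality as ≡

OddPrimePower : ℕ → Set
OddPrimePower q = ∃₂ λ p k → Prime p × ¬ (2 ∣ p) × q ≡.≡ p ℕ.^ suc k

record IsFiniteFieldOfOrder {c ℓ : Level} (F : CommutativeRing c ℓ) (n : ℕ) : Set (c ⊔ ℓ) where
  open CommutativeRing F
  field
    one≉zero : ¬ (1# ≈ 0#)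
    inverse  : ∀ x → ¬ (x ≈ 0#) → ∃ λ y → x * y ≈ 1#
    card     : Bijection setoid (≡.setoid (Fin n))

-- Geometry of PG(3,F) where F plays the role of F_{q^2}.
module PG {c ℓ : Level} (F : CommutativeRing c ℓ) (q : ℕ) where
  open CommutativeRing F

  infixr 8 _^_
  _^_ : Carrier → ℕ → Carrier
  x ^ zero  = 1#
  x ^ suc n = x * (x ^ n)

  _─_ : Carrier → Carrier → Carrier
  x ─ y = x + (- y)

  fr : Carrier → Carrier
  fr x = x ^ q

  record Vec4 : Set c where
    constructor ⟨_,_,_,_⟩
    field
      x₁ x₂ x₃ x₄ : Carrier
  open Vec4 public

  NonZero4 : Vec4 → Set ℓ
  NonZero4 v = ¬ ((x₁ v ≈ 0#) × (x₂ v ≈ 0#) × (x₃ v ≈ 0#) × (x₄ v ≈ 0#))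

  SamePoint : Vec4 → Vec4 → Set (c ⊔ ℓ)
  SamePoint u v = ∃ λ t → (x₁ u ≈ t * x₁ v) × (x₂ u ≈ t * x₂ v)
                         × (x₃ u ≈ t * x₃ v) × (x₄ u ≈ t * x₄ v)

  lin : Carrier → Vec4 → Carrier → Vec4 → Vec4
  lin l u m v = ⟨ l * x₁ u + m * x₁ v , l * x₂ u + m * x₂ v
                , l * x₃ u + m * x₃ v , l * x₄ u + m * x₄ v ⟩

  Qf : Vec4 → Carrier
  Qf v = (x₁ v * x₄ v) ─ (x₂ v * x₃ v)

  Hf : Vec4 → Carrier
  Hf v = (((x₁ v ^ suc q) ─ (x₂ v ^ suc q)) ─ (x₃ v ^ suc q)) + (x₄ v ^ suc q)

  InS : Carrier → Vec4 → Set ℓ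
  InS ξ v = Hf v ─ ((1# + 1#) * ξ * (Qf v ^ (suc q / 2))) ≈ 0#

  InPerp : Vec4 → Vec4 → Set ℓ
  InPerp p x = (((x₁ x * fr (x₁ p)) ─ (x₂ x * fr (x₂ p))) ─ (x₃ x * fr (x₃ p)))
               + (x₄ x * fr (x₄ p)) ≈ 0#

  -- the point ⟨(α, β, β^q, α^q)⟩ of the Baer subgeometry Σ
  σpt : Carrier → Carrier → Vec4
  σpt a b = ⟨ a , b , fr b , fr a ⟩

{-# OPTIONS --safe #-}
module Submission where

-- Write x̄ = x^q. On a field of order q² = p^{2k} this map is additive (Frobenius in characteristic
-- p, as p divides every inner binomial coefficient p C k) and involutive (Fermat: x^{q²} = x).
-- Hence h(u, v) = u₁v̄₁ − u₂v̄₂ − u₃v̄₃ + u₄v̄₄ is a Hermitian form with H(v) = h(v, v), while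
-- Q(v) = β(v, v) for the bilinear form β(u, v) = u₁v₄ − u₂v₃. For P = (a, b, b̄, ā) ∈ Σ one finds
-- h(P, P) = 2Q(P) and β(P, R) + β(R, P) = h(R, P), so Q(P) = 0 and R ∈ P^⊥ make h(P, P), h(R, P),
-- h(P, R) = h(R, P)‾ and β(P, R) + β(R, P) vanish. Expanding at v = λP + μR then leaves
-- H(v) = μ^{q+1} H(R) and Q(v) = μ² Q(R), and since q + 1 is even, (μ²)^{(q+1)/2} = μ^{q+1}:
-- the equation of S_ξ at v is μ^{q+1} times its equation at R.

open import Defs
open import Level using (Level)
open import Algebra.Bundles using (CommutativeMonoid; CommutativeRing)
open import Data.Nat.Base as ℕ using (ℕ; zero; suc; NonZero; _!; z<s; s<s)
import Data.Nat.Properties as ℕ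
open import Data.Nat.Divisibility using (_∣_; _∣0; ∣1⇒≡1; ∣⇒≤; m∣m*n; ∣m∣n⇒∣m+n; ∣-refl; divides-refl)
open import Data.Nat.DivMod using (_/_; m/n*n≡m)
open import Data.Nat.Primality using (Prime; euclidsLemma; prime[2]; prime⇒nonTrivial; prime⇒nonZero)
open import Data.Nat.Combinatorics using (_C_; k![n∸k]!∣n!; nCn≡1)
open import Data.Nat.Combinatorics.Specification using (nCk≡n!/k![n-k]!)
open import Data.Fin.Base using (Fin; zero; suc; toℕ; fromℕ; inject₁; punchIn)
import Data.Fin.Properties as Fin
open import Data.Fin.Permutation using (Permutation; _⟨$⟩ʳ_)
open import Data.Vec.Functional using (Vector)
open import Data.Product using (_,_)
open import Data.Sum using (_⊎_; inj₁; inj₂)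
open import Function.Bundles using (Bijection; Inverse; mk↔ₛ′)
open import Function.Definitions using (Congruent)
open import Function.Properties.Bijection using (Bijection⇒Inverse)
open import Relation.Binary.Definitions using (Decidable)
open import Relation.Binary.PropositionalEquality as ≡ using (_≡_; _≢_)
open import Relation.Nullary using (¬_; yes; no; contradiction)
open import Relation.Nullary.Decidable using (map′; decidable-stable)
import Algebra.Properties.CommutativeMonoid.Sum as CommutativeMonoidSum
import Algebra.Properties.CommutativeSemiring.Binomial as Binomial
import Algebra.Properties.CommutativeSemiring.Exp as CommutativeSemiringExp
import Algebra.Properties.Ring as RingProperties
import Algebra.Properties.Semiring.Exp as SemiringExp
import Algebra.Properties.Semiring.Mult as SemiringMult
import Algebra.Properties.Semiring.Sum as SemiringSum
import Algebra.Solver.Ring.NaturalCoefficients.Default as NaturalCoefficientsSolver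

module _ where
  open import Data.Nat.Base using (_*_; _∸_; _^_; _≤_; _<_; nonTrivial⇒≢1)
  open import Data.Nat.Properties using (m≤n⇒m≤1+n; <⇒≤; <⇒≱; ∸-monoʳ-<; _!*_!≢0)

  n∣n! : ∀ n → .{{NonZero n}} → n ∣ n !
  n∣n! (suc n) = m∣m*n (n !)

  prime∣n!⇒≤ : ∀ {p} → Prime p → ∀ n → p ∣ n ! → p ≤ n
  prime∣n!⇒≤ p-prime zero p∣1 = contradiction (∣1⇒≡1 p∣1) (nonTrivial⇒≢1 {{prime⇒nonTrivial p-prime}})
  prime∣n!⇒≤ p-prime (suc n) p∣n! with euclidsLemma (suc n) (n !) p-prime p∣n!
  ... | inj₁ p∣1+n = ∣⇒≤ p∣1+n
  ... | inj₂ p∣n!  = m≤n⇒m≤1+n (prime∣n!⇒≤ p-prime n p∣n!)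

  nCk*k!*[n∸k]!≡n! : ∀ {n k} → k ≤ n → (n C k) * (k ! * (n ∸ k) !) ≡ n !
  nCk*k!*[n∸k]!≡n! {n} {k} k≤n = ≡.trans
    (≡.cong (_* (k ! * (n ∸ k) !)) (nCk≡n!/k![n-k]! k≤n))
    (m/n*n≡m {{k !* (n ∸ k) !≢0}} (k![n∸k]!∣n! k≤n))

  prime∣pCk : ∀ {p k} → Prime p → 0 < k → k < p → p ∣ p C k
  prime∣pCk {p} {k} p-prime 0<k k<p
    with euclidsLemma (p C k) (k ! * (p ∸ k) !) p-prime
           (≡.subst (p ∣_) (≡.sym (nCk*k!*[n∸k]!≡n! (<⇒≤ k<p))) (n∣n! p {{prime⇒nonZero p-prime}}))
  ... | inj₁ p∣pCk = p∣pCk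
  ... | inj₂ p∣k![p∸k]! with euclidsLemma (k !) ((p ∸ k) !) p-prime p∣k![p∸k]!
  ...   | inj₁ p∣k!     = contradiction (prime∣n!⇒≤ p-prime k p∣k!) (<⇒≱ k<p)
  ...   | inj₂ p∣[p∸k]! = contradiction (prime∣n!⇒≤ p-prime (p ∸ k) p∣[p∸k]!) (<⇒≱ (∸-monoʳ-< 0<k (<⇒≤ k<p)))

  ¬2∣m⇒¬2∣m^n : ∀ {m} → ¬ 2 ∣ m → ∀ n → ¬ 2 ∣ m ^ n
  ¬2∣m⇒¬2∣m^n ¬2∣m zero    2∣1 = contradiction (∣1⇒≡1 2∣1) λ ()
  ¬2∣m⇒¬2∣m^n ¬2∣m (suc n) 2∣m^1+n with euclidsLemma _ _ prime[2] 2∣m^1+n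
  ... | inj₁ 2∣m   = ¬2∣m 2∣m
  ... | inj₂ 2∣m^n = ¬2∣m⇒¬2∣m^n ¬2∣m n 2∣m^n

  2∣n⊎2∣1+n : ∀ n → 2 ∣ n ⊎ 2 ∣ suc n
  2∣n⊎2∣1+n zero    = inj₁ (2 ∣0)
  2∣n⊎2∣1+n (suc n) with 2∣n⊎2∣1+n n
  ... | inj₁ 2∣n   = inj₂ (∣m∣n⇒∣m+n ∣-refl 2∣n)
  ... | inj₂ 2∣1+n = inj₁ 2∣1+n

  oddPrimePower⇒2∣1+q : ∀ {q} → OddPrimePower q → 2 ∣ suc q
  oddPrimePower⇒2∣1+q (p , k , _ , ¬2∣p , ≡.refl) with 2∣n⊎2∣1+n (p ^ suc k)
  ... | inj₁ 2∣q   = contradiction 2∣q (¬2∣m⇒¬2∣m^n ¬2∣p (suc k))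
  ... | inj₂ 2∣1+q = 2∣1+q

module _ {a ℓ} (M : CommutativeMonoid a ℓ) where
  open CommutativeMonoid M
  open CommutativeMonoidSum M
  open import Algebra.Definitions.RawMonoid rawMonoid using (_×_)
  open import Relation.Binary.Reasoning.Setoid setoid

  sum-permute-twisted : ∀ {n} (π : Permutation n n) (f g : Vector Carrier n) →
                        (∀ i → f (π ⟨$⟩ʳ i) ≈ g i ∙ f i) → sum f ≈ sum g ∙ sum f
  sum-permute-twisted π f g twist = begin
    sum f                     ≈⟨ sum-permute f π ⟩
    sum (λ i → f (π ⟨$⟩ʳ i))  ≈⟨ sum-cong-≋ twist ⟩
    sum (λ i → g i ∙ f i)     ≈⟨ ∑-distrib-+ g f ⟩
    sum g ∙ sum f             ∎

  ∙-sum-punctured : ∀ {n} (z : Fin n) (g : Vector Carrier n) {x} → g z ≈ ε →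
                    (∀ i → i ≢ z → g i ≈ x) → x ∙ sum g ≈ n × x
  ∙-sum-punctured {suc n} z g {x} gz≈ε g≈x = begin
    x ∙ sum g                                   ≈⟨ ∙-congˡ (sum-remove g) ⟩
    x ∙ (g z ∙ sum {n} (λ j → g (punchIn z j)))  ≈⟨ ∙-congˡ (∙-cong gz≈ε (sum-cong-≋ λ j → g≈x _ (Fin.punchInᵢ≢i z j))) ⟩
    x ∙ (ε ∙ sum {n} (λ _ → x))                 ≈⟨ ∙-congˡ (identityˡ _) ⟩
    x ∙ sum {n} (λ _ → x)                       ≈⟨ ∙-congˡ (sum-replicate n) ⟩
    suc n × x                                   ∎

module _ {c ℓ} (R : CommutativeRing c ℓ) where
  open CommutativeRing R hiding (zero)
  open RingProperties ring using (-‿+-comm; -‿distribʳ-*)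
  open SemiringExp semiring using (_^_; ^-congˡ; ^-assocʳ)
  open SemiringMult semiring using (_×_; ×-assoc-*; ×1-homo-*; ×-congʳ)
  open SemiringSum semiring using (sum; sum-cong-≋; sum-init-last; sum-replicate-zero)
  open Binomial commutativeSemiring using (theorem; binomialTerm)
  open NaturalCoefficientsSolver commutativeSemiring
  open import Relation.Binary.Reasoning.Setoid setoid

  PG-^≡^ : ∀ q x n → PG._^_ R q x n ≡ x ^ n
  PG-^≡^ q x zero    = ≡.refl
  PG-^≡^ q x (suc n) = ≡.cong (x *_) (PG-^≡^ q x n)

  +-distrib-lin : ∀ l m a b c d → (l * a + m * b) + (l * c + m * d) ≈ l * (a + c) + m * (b + d)
  +-distrib-lin = solve 6 (λ l m a b c d → (l :* a :+ m :* b) :+ (l :* c :+ m :* d) := l :* (a :+ c) :+ m :* (b :+ d)) refl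

  -‿distrib-lin : ∀ l m a b → - (l * a + m * b) ≈ l * - a + m * - b
  -‿distrib-lin l m a b = trans (sym (-‿+-comm (l * a) (m * b))) (+-cong (-‿distribʳ-* l a) (-‿distribʳ-* m b))

  -distrib-lin : ∀ l m a b c d → (l * a + m * b) - (l * c + m * d) ≈ l * (a - c) + m * (b - d)
  -distrib-lin l m a b c d = trans (+-congˡ (-‿distrib-lin l m c d)) (+-distrib-lin l m a b (- c) (- d))

  *-distribʳ-lin : ∀ l m a b v → (l * a + m * b) * v ≈ l * (a * v) + m * (b * v)
  *-distribʳ-lin = solve 5 (λ l m a b v → (l :* a :+ m :* b) :* v := l :* (a :* v) :+ m :* (b :* v)) refl

  *-distribˡ-lin : ∀ l m a b v → v * (l * a + m * b) ≈ l * (v * a) + m * (v * b)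
  *-distribˡ-lin = solve 5 (λ l m a b v → v :* (l :* a :+ m :* b) := l :* (v :* a) :+ m :* (v :* b)) refl

  ×1-homo-^ : ∀ m n → (m ℕ.^ n) × 1# ≈ (m × 1#) ^ n
  ×1-homo-^ m zero    = +-identityʳ 1#
  ×1-homo-^ m (suc n) = trans (×1-homo-* m (m ℕ.^ n)) (*-congˡ (×1-homo-^ m n))

  ×-vanishes : ∀ {m} → m × 1# ≈ 0# → ∀ x → m × x ≈ 0#
  ×-vanishes {m} m×1≈0 x = begin
    m × x         ≈⟨ ×-congʳ m (*-identityˡ x) ⟨
    m × (1# * x)  ≈⟨ ×-assoc-* m 1# x ⟨
    (m × 1#) * x  ≈⟨ *-congʳ m×1≈0 ⟩
    0# * x        ≈⟨ zeroˡ x ⟩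
    0#            ∎

  freshman : ∀ n .{{_ : NonZero n}} → (∀ k → 0 ℕ.< k → k ℕ.< n → (n C k) × 1# ≈ 0#) →
             ∀ x y → (x + y) ^ n ≈ x ^ n + y ^ n
  freshman (suc n) middle x y = begin
    (x + y) ^ suc n                                                ≈⟨ theorem (suc n) x y ⟩
    t zero + sum (λ i → t (suc i))                                 ≈⟨ +-congˡ (sum-init-last (λ i → t (suc i))) ⟩
    t zero + (sum (λ i → t (suc (inject₁ i))) + t (suc (fromℕ n)))  ≈⟨ +-cong first (+-cong middle≈0 last) ⟩
    y ^ suc n + (0# + x ^ suc n)                                   ≈⟨ +-comm _ _ ⟩
    (0# + x ^ suc n) + y ^ suc n                                   ≈⟨ +-congʳ (+-identityˡ _) ⟩
    x ^ suc n + y ^ suc n                                          ∎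
    where
    t : Fin (suc (suc n)) → Carrier
    t = binomialTerm x y (suc n)
    first : t zero ≈ y ^ suc n
    first = trans (+-identityʳ _) (*-identityˡ _)
    middle≈0 : sum (λ i → t (suc (inject₁ i))) ≈ 0#
    middle≈0 = trans (sum-cong-≋ λ i → ×-vanishes {suc n C toℕ (suc (inject₁ i))} (middle _ z<s (s<s (Fin.inject₁ℕ< i))) _)
                     (sum-replicate-zero n)
    last : t (suc (fromℕ n)) ≈ x ^ suc n
    last rewrite Fin.toℕ-fromℕ n | nCn≡1 (suc n) | ℕ.n∸n≡0 n = trans (+-identityʳ _) (*-identityʳ _)

  module Frobenius {p} (p-prime : Prime p) (p×1≈0 : p × 1# ≈ 0#) where

    ^p-homo-+ : ∀ x y → (x + y) ^ p ≈ x ^ p + y ^ p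
    ^p-homo-+ = freshman p {{prime⇒nonZero p-prime}} λ k 0<k k<p → p∣⇒×1≈0 (prime∣pCk p-prime 0<k k<p)
      where
      p∣⇒×1≈0 : ∀ {m} → p ∣ m → m × 1# ≈ 0#
      p∣⇒×1≈0 (divides-refl d) = trans (×1-homo-* d p) (trans (*-congˡ p×1≈0) (zeroʳ _))

    ^[p^n]-homo-+ : ∀ n x y → (x + y) ^ (p ℕ.^ n) ≈ x ^ (p ℕ.^ n) + y ^ (p ℕ.^ n)
    ^[p^n]-homo-+ zero    x y = distribʳ 1# x y
    ^[p^n]-homo-+ (suc n) x y = begin
      (x + y) ^ (p ℕ.* p ℕ.^ n)                  ≈⟨ ^-assocʳ (x + y) p (p ℕ.^ n) ⟨
      ((x + y) ^ p) ^ (p ℕ.^ n)                  ≈⟨ ^-congˡ (p ℕ.^ n) (^p-homo-+ x y) ⟩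
      (x ^ p + y ^ p) ^ (p ℕ.^ n)                ≈⟨ ^[p^n]-homo-+ n (x ^ p) (y ^ p) ⟩
      (x ^ p) ^ (p ℕ.^ n) + (y ^ p) ^ (p ℕ.^ n)  ≈⟨ +-cong (^-assocʳ x p (p ℕ.^ n)) (^-assocʳ y p (p ℕ.^ n)) ⟩
      x ^ (p ℕ.* p ℕ.^ n) + y ^ (p ℕ.* p ℕ.^ n)  ∎

module FiniteField {c ℓ} (F : CommutativeRing c ℓ) {N : ℕ} (isFF : IsFiniteFieldOfOrder F N) where
  open CommutativeRing F
  open IsFiniteFieldOfOrder isFF
  open RingProperties ring using (+-identityˡ-unique)
  open SemiringExp semiring using (_^_; ^-congˡ)
  open SemiringMult semiring using (_×_)
  open CommutativeMonoidSum +-commutativeMonoid using (sum; sum-replicate)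
  open CommutativeMonoidSum *-commutativeMonoid using () renaming (sum to product)
  open Inverse (Bijection⇒Inverse card) using (to; from; to-cong; inverseˡ; inverseʳ)
  open import Relation.Binary.Reasoning.Setoid setoid

  _≟_ : Decidable _≈_
  x ≟ y = map′ (Bijection.injective card) to-cong (to x Fin.≟ to y)

  from-to : ∀ x → from (to x) ≈ x
  from-to x = inverseʳ ≡.refl

  *-cancelʳ-nonZero : ∀ {x y z} → z ≉ 0# → x * z ≈ y * z → x ≈ y
  *-cancelʳ-nonZero {x} {y} {z} z≉0 xz≈yz with inverse z z≉0
  ... | z⁻¹ , zz⁻¹≈1 = begin
    x              ≈⟨ *-identityʳ x ⟨
    x * 1#         ≈⟨ *-congˡ zz⁻¹≈1 ⟨
    x * (z * z⁻¹)  ≈⟨ *-assoc x z z⁻¹ ⟨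
    x * z * z⁻¹    ≈⟨ *-congʳ xz≈yz ⟩
    y * z * z⁻¹    ≈⟨ *-assoc y z z⁻¹ ⟩
    y * (z * z⁻¹)  ≈⟨ *-congˡ zz⁻¹≈1 ⟩
    y * 1#         ≈⟨ *-identityʳ y ⟩
    y              ∎

  *-nonZero : ∀ {x y} → x ≉ 0# → y ≉ 0# → x * y ≉ 0#
  *-nonZero x≉0 y≉0 xy≈0 = x≉0 (*-cancelʳ-nonZero y≉0 (trans xy≈0 (sym (zeroˡ _))))

  ^-nonZero : ∀ {x} n → x ≉ 0# → x ^ n ≉ 0#
  ^-nonZero zero    x≉0 = one≉zero
  ^-nonZero (suc n) x≉0 = *-nonZero x≉0 (^-nonZero n x≉0)

  ^≈0⇒≈0 : ∀ {x} n → x ^ n ≈ 0# → x ≈ 0#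
  ^≈0⇒≈0 {x} n xⁿ≈0 = decidable-stable (x ≟ 0#) λ x≉0 → ^-nonZero n x≉0 xⁿ≈0

  product-nonZero : ∀ {n} (g : Fin n → Carrier) → (∀ i → g i ≉ 0#) → product g ≉ 0#
  product-nonZero {zero}  g g≉0 = one≉zero
  product-nonZero {suc n} g g≉0 = *-nonZero (g≉0 _) (product-nonZero (λ i → g (suc i)) (λ i → g≉0 _))

  inducedPermutation : (f g : Carrier → Carrier) → Congruent _≈_ _≈_ f → Congruent _≈_ _≈_ g →
                       (∀ x → f (g x) ≈ x) → (∀ x → g (f x) ≈ x) → Permutation N N
  inducedPermutation f g f-cong g-cong fg≈id gf≈id = mk↔ₛ′
    (λ i → to (f (from i))) (λ i → to (g (from i)))
    (λ i → inverseˡ (trans (f-cong (from-to _)) (fg≈id _)))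
    (λ i → inverseˡ (trans (g-cong (from-to _)) (gf≈id _)))

  N×1≈0 : N × 1# ≈ 0#
  N×1≈0 = +-identityˡ-unique (N × 1#) (sum from) (sym (begin
    sum from                         ≈⟨ sum-permute-twisted +-commutativeMonoid π from (λ _ → 1#) (λ i → trans (from-to _) (+-comm _ _)) ⟩
    sum {N} (λ _ → 1#) + sum from    ≈⟨ +-congʳ (sum-replicate N) ⟩
    N × 1# + sum from                ∎))
    where
    π : Permutation N N
    π = inducedPermutation (_+ 1#) (_- 1#) +-congʳ +-congʳ
          (λ x → trans (+-assoc x _ _) (trans (+-congˡ (-‿inverseˡ 1#)) (+-identityʳ x)))
          (λ x → trans (+-assoc x _ _) (trans (+-congˡ (-‿inverseʳ 1#)) (+-identityʳ x)))

  ifZero_then_else_ : Carrier → Carrier → Carrier → Carrier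
  ifZero y then a else b with y ≟ 0#
  ... | yes _ = a
  ... | no  _ = b

  ifZero-zero : ∀ {y a b} → y ≈ 0# → ifZero y then a else b ≈ a
  ifZero-zero {y} y≈0 with y ≟ 0#
  ... | yes _   = refl
  ... | no y≉0  = contradiction y≈0 y≉0

  ifZero-nonZero : ∀ {y a b} → y ≉ 0# → ifZero y then a else b ≈ b
  ifZero-nonZero {y} y≉0 with y ≟ 0#
  ... | yes y≈0 = contradiction y≈0 y≉0
  ... | no _    = refl

  zeroToOne : Carrier → Carrier
  zeroToOne y = ifZero y then 1# else y

  zeroToOne-nonZero : ∀ y → zeroToOne y ≉ 0#
  zeroToOne-nonZero y with y ≟ 0#
  ... | yes _   = one≉zero
  ... | no y≉0  = y≉0

  zeroToOne-cong : ∀ {y y′} → y ≈ y′ → zeroToOne y ≈ zeroToOne y′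
  zeroToOne-cong {y} {y′} y≈y′ with y ≟ 0#
  ... | yes y≈0 = sym (ifZero-zero (trans (sym y≈y′) y≈0))
  ... | no y≉0  = trans y≈y′ (sym (ifZero-nonZero λ y′≈0 → y≉0 (trans y≈y′ y′≈0)))

  zeroToOne-*ˡ : ∀ {x} → x ≉ 0# → ∀ y → zeroToOne (x * y) ≈ (ifZero y then 1# else x) * zeroToOne y
  zeroToOne-*ˡ {x} x≉0 y with y ≟ 0#
  ... | yes y≈0 = trans (ifZero-zero (trans (*-congˡ y≈0) (zeroʳ x))) (sym (*-identityˡ 1#))
  ... | no y≉0  = ifZero-nonZero (*-nonZero x≉0 y≉0)

  0^n≈0 : ∀ n → .{{NonZero n}} → 0# ^ n ≈ 0#
  0^n≈0 (suc n) = zeroˡ _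

  -- Multiplying by x permutes F; after replacing 0 by 1 every factor of the product over F is
  -- nonzero, and all of them except the one at 0 get scaled by x.
  fermat-nonZero : ∀ {x} → x ≉ 0# → x ^ N ≈ x
  fermat-nonZero {x} x≉0 with inverse x x≉0
  ... | x⁻¹ , xx⁻¹≈1 = sym (*-cancelʳ-nonZero (product-nonZero g (λ i → zeroToOne-nonZero (from i))) (begin
    x * product g                     ≈⟨ *-congˡ (sum-permute-twisted *-commutativeMonoid π g factor twist) ⟩
    x * (product factor * product g)  ≈⟨ *-assoc _ _ _ ⟨
    x * product factor * product g    ≈⟨ *-congʳ (∙-sum-punctured *-commutativeMonoid (to 0#) factor factor-zero factor-nonZero) ⟩
    x ^ N * product g                 ∎))
    where
    g factor : Fin N → Carrier
    g i      = zeroToOne (from i)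
    factor i = ifZero from i then 1# else x
    π : Permutation N N
    π = inducedPermutation (x *_) (x⁻¹ *_) *-congˡ *-congˡ
          (λ y → trans (sym (*-assoc _ _ _)) (trans (*-congʳ xx⁻¹≈1) (*-identityˡ y)))
          (λ y → trans (sym (*-assoc _ _ _)) (trans (*-congʳ (trans (*-comm _ _) xx⁻¹≈1)) (*-identityˡ y)))
    factor-zero : factor (to 0#) ≈ 1#
    factor-zero = ifZero-zero (from-to 0#)
    factor-nonZero : ∀ i → i ≢ to 0# → factor i ≈ x
    factor-nonZero i i≢z = ifZero-nonZero λ fromi≈0 → i≢z (≡.trans (≡.sym (inverseˡ refl)) (to-cong fromi≈0))
    twist : ∀ i → g (π ⟨$⟩ʳ i) ≈ factor i * g i
    twist i = trans (zeroToOne-cong (from-to _)) (zeroToOne-*ˡ x≉0 (from i))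

  fermat : ∀ x → x ^ N ≈ x
  fermat x with x ≟ 0#
  ... | no x≉0  = fermat-nonZero x≉0
  ... | yes x≈0 = begin
    x ^ N   ≈⟨ ^-congˡ N x≈0 ⟩
    0# ^ N  ≈⟨ 0^n≈0 N {{Fin.nonZeroIndex (to 0#)}} ⟩
    0#      ≈⟨ x≈0 ⟨
    x       ∎

  N≡pⁿ⇒p×1≈0 : ∀ {p n} → N ≡ p ℕ.^ n → p × 1# ≈ 0#
  N≡pⁿ⇒p×1≈0 {p} {n} N≡pⁿ = ^≈0⇒≈0 n (begin
    (p × 1#) ^ n    ≈⟨ ×1-homo-^ F p n ⟨
    (p ℕ.^ n) × 1#  ≡⟨ ≡.cong (_× 1#) N≡pⁿ ⟨
    N × 1#          ≈⟨ N×1≈0 ⟩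
    0#              ∎)

module Geometry {c ℓ} (F : CommutativeRing c ℓ) (q : ℕ) where
  open CommutativeRing F
  open PG F q
  open RingProperties ring using (x+x≈x⇒x≈0; +-inverseʳ-unique; x[y-z]≈xy-xz)
  module Exp = SemiringExp semiring
  module CExp = CommutativeSemiringExp commutativeSemiring
  open NaturalCoefficientsSolver commutativeSemiring
  open import Relation.Binary.Reasoning.Setoid setoid

  ^-congˡ : ∀ n {x y} → x ≈ y → x ^ n ≈ y ^ n
  ^-congˡ n {x} {y} x≈y = begin
    x ^ n        ≡⟨ PG-^≡^ F q x n ⟩
    x Exp.^ n    ≈⟨ Exp.^-congˡ n x≈y ⟩
    y Exp.^ n    ≡⟨ PG-^≡^ F q y n ⟨
    y ^ n        ∎

  ^-distrib-* : ∀ x y n → (x * y) ^ n ≈ x ^ n * y ^ n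
  ^-distrib-* x y n = begin
    (x * y) ^ n            ≡⟨ PG-^≡^ F q (x * y) n ⟩
    (x * y) Exp.^ n        ≈⟨ CExp.^-distrib-* x y n ⟩
    x Exp.^ n * y Exp.^ n  ≡⟨ ≡.cong₂ _*_ (PG-^≡^ F q x n) (PG-^≡^ F q y n) ⟨
    x ^ n * y ^ n          ∎

  fr-cong : ∀ {x y} → x ≈ y → fr x ≈ fr y
  fr-cong = ^-congˡ q

  fr-* : ∀ x y → fr (x * y) ≈ fr x * fr y
  fr-* x y = ^-distrib-* x y q

  square-^-half : ∀ {n} → 2 ∣ n → ∀ x → (x * x) ^ (n / 2) ≈ x ^ n
  square-^-half {n} 2∣n x = begin
    (x * x) ^ (n / 2)                ≡⟨ PG-^≡^ F q (x * x) (n / 2) ⟩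
    (x * x) Exp.^ (n / 2)            ≈⟨ Exp.^-congˡ (n / 2) (*-congˡ (*-identityʳ x)) ⟨
    (x Exp.^ 2) Exp.^ (n / 2)        ≈⟨ Exp.^-assocʳ x 2 (n / 2) ⟩
    x Exp.^ (2 ℕ.* (n / 2))          ≡⟨ ≡.cong (x Exp.^_) (≡.trans (ℕ.*-comm 2 (n / 2)) (m/n*n≡m 2∣n)) ⟩
    x Exp.^ n                        ≡⟨ PG-^≡^ F q x n ⟨
    x ^ n                            ∎

  signedSum : Carrier → Carrier → Carrier → Carrier → Carrier
  signedSum a b c d = ((a ─ b) ─ c) + d

  signedSum-cong : ∀ {a a′ b b′ c c′ d d′} → a ≈ a′ → b ≈ b′ → c ≈ c′ → d ≈ d′ →
                   signedSum a b c d ≈ signedSum a′ b′ c′ d′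
  signedSum-cong a≈ b≈ c≈ d≈ = +-cong (+-cong (+-cong a≈ (-‿cong b≈)) (-‿cong c≈)) d≈

  signedSum-distrib-lin : ∀ l m a a′ b b′ c c′ d d′ →
    signedSum (l * a + m * a′) (l * b + m * b′) (l * c + m * c′) (l * d + m * d′)
    ≈ l * signedSum a b c d + m * signedSum a′ b′ c′ d′
  signedSum-distrib-lin l m a a′ b b′ c c′ d d′ = trans
    (+-congʳ (trans (+-congʳ (-distrib-lin F l m a a′ b b′)) (-distrib-lin F l m _ _ c c′)))
    (+-distrib-lin F l m _ _ d d′)

  -- Hf v and herm v v, InPerp p x and herm x p ≈ 0#, Qf v and qform v v agree definitionally.
  herm : Vec4 → Vec4 → Carrier
  herm u v = signedSum (x₁ u * fr (x₁ v)) (x₂ u * fr (x₂ v)) (x₃ u * fr (x₃ v)) (x₄ u * fr (x₄ v))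

  herm-linearˡ : ∀ l u m w v → herm (lin l u m w) v ≈ l * herm u v + m * herm w v
  herm-linearˡ l u m w v = trans
    (signedSum-cong (*-distribʳ-lin F l m _ _ _) (*-distribʳ-lin F l m _ _ _)
                    (*-distribʳ-lin F l m _ _ _) (*-distribʳ-lin F l m _ _ _))
    (signedSum-distrib-lin l m _ _ _ _ _ _ _ _)

  qform : Vec4 → Vec4 → Carrier
  qform u w = (x₁ u * x₄ w) ─ (x₂ u * x₃ w)

  qform-linearˡ : ∀ l u m w v → qform (lin l u m w) v ≈ l * qform u v + m * qform w v
  qform-linearˡ l u m w v = trans (+-cong (*-distribʳ-lin F l m _ _ _) (-‿cong (*-distribʳ-lin F l m _ _ _)))
                                  (-distrib-lin F l m _ _ _ _)

  qform-linearʳ : ∀ v l u m w → qform v (lin l u m w) ≈ l * qform v u + m * qform v w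
  qform-linearʳ v l u m w = trans (+-cong (*-distribˡ-lin F l m _ _ _) (-‿cong (*-distribˡ-lin F l m _ _ _)))
                                  (-distrib-lin F l m _ _ _ _)

  module _ (σ : Carrier → Carrier) (f : Vec4 → Vec4 → Carrier)
           (f-linearˡ : ∀ l u m w v → f (lin l u m w) v ≈ l * f u v + m * f w v)
           (f-semilinearʳ : ∀ v l u m w → f v (lin l u m w) ≈ σ l * f v u + σ m * f v w) where

    sesquilinear-diagonal : ∀ l u m w → f (lin l u m w) (lin l u m w)
                            ≈ l * (σ l * f u u + σ m * f u w) + m * (σ l * f w u + σ m * f w w)
    sesquilinear-diagonal l u m w = trans (f-linearˡ l u m w _)
      (+-cong (*-congˡ (f-semilinearʳ u l u m w)) (*-congˡ (f-semilinearʳ w l u m w)))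

  Qf-lin : ∀ l u m w → Qf u ≈ 0# → qform u w + qform w u ≈ 0# → Qf (lin l u m w) ≈ m * m * Qf w
  Qf-lin l u m w Qu≈0 polar≈0 = begin
    Qf (lin l u m w)
      ≈⟨ sesquilinear-diagonal (λ x → x) qform qform-linearˡ qform-linearʳ l u m w ⟩
    l * (l * Qf u + m * qform u w) + m * (l * qform w u + m * Qf w)
      ≈⟨ solve 6 (λ l m a b c d → l :* (l :* a :+ m :* b) :+ m :* (l :* c :+ m :* d) := l :* l :* a :+ l :* m :* (b :+ c) :+ m :* m :* d) refl l m (Qf u) (qform u w) (qform w u) (Qf w) ⟩
    l * l * Qf u + l * m * (qform u w + qform w u) + m * m * Qf w
      ≈⟨ +-congʳ (+-cong (*-congˡ Qu≈0) (*-congˡ polar≈0)) ⟩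
    l * l * 0# + l * m * 0# + m * m * Qf w
      ≈⟨ solve 3 (λ a b c → a :* con 0 :+ b :* con 0 :+ c := c) refl (l * l) (l * m) (m * m * Qf w) ⟩
    m * m * Qf w ∎

  InS-scale : 2 ∣ suc q → ∀ ξ {v w} m → Hf v ≈ m * fr m * Hf w → Qf v ≈ m * m * Qf w → InS ξ w → InS ξ v
  InS-scale 2∣1+q ξ {v} {w} m Hv≈ Qv≈ Sw = begin
    Hf v ─ (T * Qf v ^ e)              ≈⟨ +-cong Hv≈ (-‿cong (*-congˡ Qv^e≈)) ⟩
    (μ * Hf w) ─ (T * (μ * Qf w ^ e))  ≈⟨ +-congˡ (-‿cong (solve 3 (λ T μ Z → T :* (μ :* Z) := μ :* (T :* Z)) refl T μ (Qf w ^ e))) ⟩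
    (μ * Hf w) ─ (μ * (T * Qf w ^ e))  ≈⟨ x[y-z]≈xy-xz μ (Hf w) (T * Qf w ^ e) ⟨
    μ * (Hf w ─ (T * Qf w ^ e))        ≈⟨ *-congˡ Sw ⟩
    μ * 0#                             ≈⟨ zeroʳ μ ⟩
    0#                                 ∎
    where
    T μ : Carrier
    T = (1# + 1#) * ξ
    μ = m * fr m
    e : ℕ
    e = suc q / 2
    Qv^e≈ : Qf v ^ e ≈ μ * Qf w ^ e
    Qv^e≈ = trans (^-congˡ e Qv≈) (trans (^-distrib-* (m * m) (Qf w) e) (*-congʳ (square-^-half 2∣1+q m)))

  module _ (fr-+ : ∀ x y → fr (x + y) ≈ fr x + fr y) (fr-involutive : ∀ x → fr (fr x) ≈ x) where

    fr-0 : fr 0# ≈ 0#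
    fr-0 = x+x≈x⇒x≈0 (fr 0#) (trans (sym (fr-+ 0# 0#)) (fr-cong (+-identityʳ 0#)))

    fr-neg : ∀ x → fr (- x) ≈ - fr x
    fr-neg x = +-inverseʳ-unique (fr x) (fr (- x)) (trans (sym (fr-+ x (- x))) (trans (fr-cong (-‿inverseʳ x)) fr-0))

    fr-signedSum : ∀ a b c d → fr (signedSum a b c d) ≈ signedSum (fr a) (fr b) (fr c) (fr d)
    fr-signedSum a b c d = begin
      fr (((a ─ b) ─ c) + d)             ≈⟨ fr-+ _ d ⟩
      fr ((a ─ b) ─ c) + fr d            ≈⟨ +-congʳ (trans (fr-+ _ (- c)) (+-cong (fr-+ a (- b)) (fr-neg c))) ⟩
      ((fr a + fr (- b)) ─ fr c) + fr d  ≈⟨ +-congʳ (+-congʳ (+-congˡ (fr-neg b))) ⟩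
      signedSum (fr a) (fr b) (fr c) (fr d) ∎

    herm-semilinearʳ : ∀ v l u m w → herm v (lin l u m w) ≈ fr l * herm v u + fr m * herm v w
    herm-semilinearʳ v l u m w = trans
      (signedSum-cong (coordinate (x₁ v) (x₁ u) (x₁ w)) (coordinate (x₂ v) (x₂ u) (x₂ w))
                      (coordinate (x₃ v) (x₃ u) (x₃ w)) (coordinate (x₄ v) (x₄ u) (x₄ w)))
      (signedSum-distrib-lin (fr l) (fr m) _ _ _ _ _ _ _ _)
      where
      coordinate : ∀ a b c → a * fr (l * b + m * c) ≈ fr l * (a * fr b) + fr m * (a * fr c)
      coordinate a b c = trans (*-congˡ (trans (fr-+ _ _) (+-cong (fr-* l b) (fr-* m c))))
                               (*-distribˡ-lin F (fr l) (fr m) (fr b) (fr c) a)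

    herm-conj : ∀ u v → fr (herm u v) ≈ herm v u
    herm-conj u v = trans (fr-signedSum _ _ _ _)
      (signedSum-cong (coordinate (x₁ u) (x₁ v)) (coordinate (x₂ u) (x₂ v))
                      (coordinate (x₃ u) (x₃ v)) (coordinate (x₄ u) (x₄ v)))
      where
      coordinate : ∀ a b → fr (a * fr b) ≈ b * fr a
      coordinate a b = trans (fr-* a (fr b)) (trans (*-congˡ (fr-involutive b)) (*-comm (fr a) b))

    Hf-lin : ∀ l u m w → herm u u ≈ 0# → herm w u ≈ 0# → Hf (lin l u m w) ≈ m * fr m * Hf w
    Hf-lin l u m w huu≈0 hwu≈0 = begin
      Hf (lin l u m w)
        ≈⟨ sesquilinear-diagonal fr herm herm-linearˡ herm-semilinearʳ l u m w ⟩
      l * (fr l * herm u u + fr m * herm u w) + m * (fr l * herm w u + fr m * Hf w)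
        ≈⟨ +-cong (*-congˡ (+-cong (*-congˡ huu≈0) (*-congˡ huw≈0))) (*-congˡ (+-congʳ (*-congˡ hwu≈0))) ⟩
      l * (fr l * 0# + fr m * 0#) + m * (fr l * 0# + fr m * Hf w)
        ≈⟨ solve 5 (λ l m a b h → l :* (a :* con 0 :+ b :* con 0) :+ m :* (a :* con 0 :+ b :* h) := m :* b :* h) refl l m (fr l) (fr m) (Hf w) ⟩
      m * fr m * Hf w ∎
      where
      huw≈0 : herm u w ≈ 0#
      huw≈0 = trans (sym (herm-conj w u)) (trans (fr-cong hwu≈0) fr-0)

    herm-σpt : ∀ a b → herm (σpt a b) (σpt a b) ≈ Qf (σpt a b) + Qf (σpt a b)
    herm-σpt a b = begin
      signedSum (a * fr a) (b * fr b) (fr b * fr (fr b)) (fr a * fr (fr a))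
        ≈⟨ signedSum-cong refl refl (conjugate b) (conjugate a) ⟩
      signedSum (a * fr a) (b * fr b) (b * fr b) (a * fr a)
        ≈⟨ solve 2 (λ A B′ → ((A :+ B′) :+ B′) :+ A := (A :+ B′) :+ (A :+ B′)) refl (a * fr a) (- (b * fr b)) ⟩
      Qf (σpt a b) + Qf (σpt a b) ∎
      where
      conjugate : ∀ x → fr x * fr (fr x) ≈ x * fr x
      conjugate x = trans (*-congˡ (fr-involutive x)) (*-comm (fr x) x)

    qform-σpt : ∀ a b R → qform (σpt a b) R + qform R (σpt a b) ≈ herm R (σpt a b)
    qform-σpt a b R = begin
      ((a * x₄ R) ─ (b * x₃ R)) + ((x₁ R * fr a) ─ (x₂ R * fr b))
        ≈⟨ solve 4 (λ Y Z′ X₁ X₂′ → (Y :+ Z′) :+ (X₁ :+ X₂′) := ((X₁ :+ X₂′) :+ Z′) :+ Y) refl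
                 (a * x₄ R) (- (b * x₃ R)) (x₁ R * fr a) (- (x₂ R * fr b)) ⟩
      signedSum (x₁ R * fr a) (x₂ R * fr b) (b * x₃ R) (a * x₄ R)
        ≈⟨ signedSum-cong refl refl (unconjugate b (x₃ R)) (unconjugate a (x₄ R)) ⟨
      herm R (σpt a b) ∎
      where
      unconjugate : ∀ x y → y * fr (fr x) ≈ x * y
      unconjugate x y = trans (*-congˡ (fr-involutive x)) (*-comm y x)

    lin-σpt-InS : 2 ∣ suc q → ∀ a b → Qf (σpt a b) ≈ 0# → ∀ ξ R → InS ξ R → InPerp (σpt a b) R →
                  ∀ l m → InS ξ (lin l (σpt a b) m R)
    lin-σpt-InS 2∣1+q a b QP≈0 ξ R R∈S R⊥P l m = InS-scale 2∣1+q ξ m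
      (Hf-lin l (σpt a b) m R (trans (herm-σpt a b) (trans (+-cong QP≈0 QP≈0) (+-identityʳ 0#))) R⊥P)
      (Qf-lin l (σpt a b) m R QP≈0 (trans (qform-σpt a b R) R⊥P))
      R∈S

module _ {c ℓ} (F : CommutativeRing c ℓ) (q : ℕ) (isFF : IsFiniteFieldOfOrder F (q ℕ.^ 2)) where
  open CommutativeRing F
  open PG F q using (fr)
  open SemiringExp semiring using (_^_; ^-assocʳ)
  open import Relation.Binary.Reasoning.Setoid setoid

  frobenius-+ : ∀ {p n} → Prime p → q ≡ p ℕ.^ n → ∀ x y → fr (x + y) ≈ fr x + fr y
  frobenius-+ {p} {n} p-prime q≡pⁿ x y = begin
    fr (x + y)                     ≡⟨ PG-^≡^ F q (x + y) q ⟩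
    (x + y) ^ q                    ≡⟨ ≡.cong ((x + y) ^_) q≡pⁿ ⟩
    (x + y) ^ (p ℕ.^ n)            ≈⟨ Frobenius.^[p^n]-homo-+ F p-prime (FiniteField.N≡pⁿ⇒p×1≈0 F isFF {p} {n ℕ.* 2} q²≡p^[n*2]) n x y ⟩
    x ^ (p ℕ.^ n) + y ^ (p ℕ.^ n)  ≡⟨ ≡.cong (λ j → x ^ j + y ^ j) q≡pⁿ ⟨
    x ^ q + y ^ q                  ≡⟨ ≡.cong₂ _+_ (PG-^≡^ F q x q) (PG-^≡^ F q y q) ⟨
    fr x + fr y                    ∎
    where
    q²≡p^[n*2] : q ℕ.^ 2 ≡ p ℕ.^ (n ℕ.* 2)
    q²≡p^[n*2] = ≡.trans (≡.cong (ℕ._^ 2) q≡pⁿ) (ℕ.^-*-assoc p n 2)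

  frobenius-involutive : ∀ x → fr (fr x) ≈ x
  frobenius-involutive x = begin
    fr (fr x)      ≡⟨ ≡.trans (PG-^≡^ F q (fr x) q) (≡.cong (_^ q) (PG-^≡^ F q x q)) ⟩
    (x ^ q) ^ q    ≈⟨ ^-assocʳ x q q ⟩
    x ^ (q ℕ.* q)  ≡⟨ ≡.cong (λ j → x ^ (q ℕ.* j)) (ℕ.*-identityʳ q) ⟨
    x ^ (q ℕ.^ 2)  ≈⟨ FiniteField.fermat F isFF x ⟩
    x              ∎

open import Data.Nat using (_*_; _∸_; _^_)
open import Data.Product using (_×_)

-- Only Q(P) = 0, R ∈ S_ξ and R ∈ P^⊥ are needed: the conditions on ξ and on P, R being distinct
-- points are not.
mainTheorem13 : ∀ {c ℓ : Level} (q : ℕ) → OddPrimePower q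
    → (F : CommutativeRing c ℓ) → IsFiniteFieldOfOrder F (q ^ 2)
    → ∀ (a b : CommutativeRing.Carrier F)
    → ¬ (CommutativeRing._≈_ F a (CommutativeRing.0# F) × CommutativeRing._≈_ F b (CommutativeRing.0# F))
    → CommutativeRing._≈_ F (PG.Qf F q (PG.σpt F q a b)) (CommutativeRing.0# F)
    → ∀ (ξ : CommutativeRing.Carrier F)
    → CommutativeRing._≈_ F (PG._^_ F q ξ (2 * (q ∸ 1))) (CommutativeRing.1# F)
    → ∀ (R : PG.Vec4 F q) → PG.NonZero4 F q R
    → ¬ PG.SamePoint F q R (PG.σpt F q a b)
    → PG.InS F q ξ R
    → PG.InPerp F q (PG.σpt F q a b) R
    → ∀ (l m : CommutativeRing.Carrier F)
    → PG.InS F q ξ (PG.lin F q l (PG.σpt F q a b) m R)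
mainTheorem13 q q-odd@(p , k , p-prime , _ , q≡pᵏ) F isFF a b _ QP≈0 ξ _ R _ _ R∈S R⊥P l m =
  Geometry.lin-σpt-InS F q (frobenius-+ F q isFF {n = suc k} p-prime q≡pᵏ) (frobenius-involutive F q isFF)
    (oddPrimePower⇒2∣1+q q-odd) a b QP≈0 ξ R R∈S R⊥P l m
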